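{- Let $G$ be a connected graph of order $n\geq 4$ with maximum degree $\Delta(G)$, and let $C(G)$ be its central graph. Then $D(C(G))\leq \lceil \sqrt{\Delta(G)}\rceil$.
   Context: All graphs are simple, finite, undirected. The central graph $C(G)$ of $G$ has vertex set $V(G)\cup\{w_{u,v}:\{u,v\}\in E(G)\}$ (one new vertex $w_{u,v}$ for each edge of $G$), and edge set consisting of all pairs $\{u,v\}$ with $u\neq v\in V(G)$ and $\{u,v\}\notin E(G)$, together with the edges $\{u,w_{u,v}\}$ and $\{w_{u,v},v\}$ for every $\{u,v\}\in E(G)$. An automorphism $\phi$ of a graph $H$ preserves a vertex coloring $f$ (not necessarily proper) if $f(\phi(x))=f(x)$ for all vertices $x$. The distinguishing number $D(H)$ is the least integer $d$ such that $H$ has a vertex coloring with $d$ colors preserved only by the identity automorphism. -}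

module Defs where

open import Data.Nat using (ℕ; zero; suc; _≤_; _*_; _⊔_; _≤ᵇ_)
open import Data.Bool using (Bool; true; false; T; if_then_else_)
open import Data.Fin using (Fin) renaming (_<_ to _<ᶠ_)
open import Data.List using (List; map; foldr; allFin)
open import Data.Nat.ListAction using (sum)
open import Data.Product using (Σ; _×_; _,_)
open import Data.Sum using (_⊎_; inj₁; inj₂)
open import Data.Empty using (⊥)
open import Relation.Binary.PropositionalEquality using (_≡_; _≢_)
open import Function.Definitions using (Bijective)
open import Function.Bundles using (_⇔_)

record SimpleGraph (n : ℕ) : Set where
  field
    adj     : Fin n → Fin n → Bool
    sym     : ∀ u v → adj u v ≡ adj v u
    irrefl  : ∀ v → adj v v ≡ false
open SimpleGraph public

degree : ∀ {n} → SimpleGraph n → Fin n → ℕ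
degree {n} G v = sum (map (λ u → if adj G v u then 1 else 0) (allFin n))

maxDegree : ∀ {n} → SimpleGraph n → ℕ
maxDegree {n} G = foldr _⊔_ 0 (map (degree G) (allFin n))

data Reachable {n} (G : SimpleGraph n) : Fin n → Fin n → Set where
  here : ∀ {u} → Reachable G u u
  step : ∀ {u v w} → T (adj G u v) → Reachable G v w → Reachable G u w

Connected : ∀ {n} → SimpleGraph n → Set
Connected {n} G = ∀ (u v : Fin n) → Reachable G u v

record Graph : Set₁ where
  field
    V : Set
    E : V → V → Set
open Graph public

record Automorphism (H : Graph) : Set where
  field
    fun       : V H → V H
    bijective : Bijective _≡_ _≡_ fun
    preserves : ∀ x y → E H x y ⇔ E H (fun x) (fun y)
open Automorphism public

Distinguishing : (H : Graph) (d : ℕ) → (V H → Fin d) → Set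
Distinguishing H d f =
  (φ : Automorphism H) → (∀ x → f (fun φ x) ≡ f x) → ∀ x → fun φ x ≡ x

HasDistinguishingColouring : Graph → ℕ → Set
HasDistinguishingColouring H d = Σ (V H → Fin d) (Distinguishing H d)

-- D(H) ≤ k : the least d admitting a distinguishing d-colouring is ≤ k,
-- i.e. some d ≤ k admits a distinguishing d-colouring.
DistNumberAtMost : Graph → ℕ → Set
DistNumberAtMost H k = Σ ℕ (λ d → d ≤ k × HasDistinguishingColouring H d)

-- Central graph C(G).  The vertex w_{u,v} for the edge {u,v} is
-- represented by the ordered pair (u , v) with u < v.

EdgeVertex : ∀ {n} → SimpleGraph n → Set
EdgeVertex {n} G = Σ (Fin n) (λ u → Σ (Fin n) (λ v → u <ᶠ v × T (adj G u v)))

CV : ∀ {n} → SimpleGraph n → Set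
CV {n} G = Fin n ⊎ EdgeVertex G

CE : ∀ {n} (G : SimpleGraph n) → CV G → CV G → Set
CE G (inj₁ u) (inj₁ v) = u ≢ v × adj G u v ≡ false
CE G (inj₁ x) (inj₂ (u , v , _)) = x ≡ u ⊎ x ≡ v
CE G (inj₂ (u , v , _)) (inj₁ x) = x ≡ u ⊎ x ≡ v
CE G (inj₂ _) (inj₂ _) = ⊥

central : ∀ {n} → SimpleGraph n → Graph
central G = record { V = CV G ; E = CE G }

ceilSqrt-go : ℕ → ℕ → ℕ → ℕ
ceilSqrt-go m k zero = k
ceilSqrt-go m k (suc fuel) = if m ≤ᵇ k * k then k else ceilSqrt-go m (suc k) fuel

ceilSqrt : ℕ → ℕ
ceilSqrt m = ceilSqrt-go m 0 m

-- In C(G) every vertex of G has n - 1 ≥ 3 neighbours and every edge vertex has two, so an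
-- automorphism of C(G) is an automorphism σ of G, acting on edge vertices through their
-- endpoints. A colouring of C(G) is therefore a colouring of the vertices and edges of G, and it
-- is distinguishing as soon as only the identity of G preserves it.
--
-- Let d = ⌈√Δ⌉ ≥ 2 and fix a breadth-first spanning tree rooted at r, each vertex taking the least
-- neighbour on the previous level as its parent. Every non-root vertex gets a code in d × d: its
-- own colour and the colour of the edge to its parent; edges outside the tree get colour 0. The
-- children of p number at most deg p ≤ d², and fewer when p ≠ r, so they receive distinct codes
-- while leaving free one code that depends only on the colour of p. Giving that code to a child of
-- the root makes r the only vertex of colour 0 with an edge of colour 1 to a vertex of colour 1.
-- Hence σ fixes r, preserves levels and parents, and by induction on the level fixes every vertex,
-- because siblings have distinct codes.

module Submission where

open import Defs renaming (sym to adj-sym)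
open import Data.Bool using (Bool; true; false; T; if_then_else_; _∧_)
open import Data.Bool.Properties using (T-∧; T-irrelevant; ⇔→≡)
open import Data.Empty using (⊥; ⊥-elim)
open import Data.Fin using (Fin; zero; suc; toℕ; punchIn; combine; remQuot; quotient; remainder) renaming (_<_ to _<ᶠ_)
import Data.Fin.Properties as Fin
open import Data.Fin.Properties using (toℕ-fromℕ<; remQuot-combine; combine-remQuot)
open import Data.Fin.Permutation using (transpose; _⟨$⟩ʳ_)
open import Data.List using ([]; _∷_; map; foldr; allFin)
open import Data.List.Membership.Propositional using (_∈_)
open import Data.List.Membership.Propositional.Properties using (∈-allFin; ∈-map⁺)
open import Data.List.Relation.Unary.Any using (here; there)
import Data.Nat as ℕ
open import Data.Nat using (ℕ; zero; suc; _+_; _*_; _≤_; _<_; _⊔_; _≤ᵇ_; z≤n; s≤s)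
open import Data.Nat.DivMod using (_mod_; _%_; m<n⇒m%n≡m; m%n<n)
open import Data.Nat.ListAction using (sum)
open import Data.Nat.Properties
  using ( ≤-refl; ≤-reflexive; ≤-trans; ≤-antisym; ≤-pred; <-irrefl; <-asym; <⇒≤; ≤-<-trans; <-≤-trans
        ; ≮⇒≥; 1+n≰n; 1+n≢0; n≤0⇒n≡0; suc-injective; m≤n⇒m<n∨m≡n; ≤ᵇ⇒≤
        ; +-identityʳ; +-suc; +-mono-≤; +-mono-<-≤; +-mono-≤-<; m≤m*n; m≤m⊔n; m≤n⊔m
        ; module ≤-Reasoning )
open import Data.Product using (Σ; ∃; ∃₂; _×_; _,_; proj₁; proj₂)
open import Data.Sum using (_⊎_; inj₁; inj₂)
import Data.Sum as Sum
open import Data.Sum.Properties using (inj₁-injective; inj₂-injective)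
open import Function using (_∘_)
open import Function.Bundles using (Equivalence; Injection; _⇔_; mk⇔)
open import Function.Properties.Inverse using (↔⇒↣)
open import Relation.Binary.Definitions using (Trichotomous; tri<; tri≈; tri>)
open import Relation.Binary.PropositionalEquality
  using (_≡_; _≢_; refl; sym; trans; cong; cong₂; subst; subst₂; module ≡-Reasoning)
open import Relation.Nullary using (¬_; Dec; yes; no; ¬?; _×-dec_; _⊎-dec_)
open import Relation.Nullary.Decidable using (T?; ⌊_⌋; toWitness; fromWitness; dec-true; dec-false)
open import Relation.Unary using (Decidable)

count : ∀ {n} → (Fin n → Bool) → ℕ
count {n} P = sum (map (λ u → if P u then 1 else 0) (allFin n))

module _ {A : Set} {f g : A → ℕ} (f≤g : ∀ x → f x ≤ g x) where

  sum-map-mono-≤ : ∀ xs → sum (map f xs) ≤ sum (map g xs)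
  sum-map-mono-≤ [] = z≤n
  sum-map-mono-≤ (x ∷ xs) = +-mono-≤ (f≤g x) (sum-map-mono-≤ xs)

  sum-map-mono-< : ∀ {x xs} → f x < g x → x ∈ xs → sum (map f xs) < sum (map g xs)
  sum-map-mono-< fx<gx (here {xs = xs} refl) = +-mono-<-≤ fx<gx (sum-map-mono-≤ xs)
  sum-map-mono-< fx<gx (there x∈xs) = +-mono-≤-< (f≤g _) (sum-map-mono-< fx<gx x∈xs)

module _ {n} {P Q : Fin n → Bool} (P⊆Q : ∀ u → T (P u) → T (Q u)) where

  private
    indicator-mono : ∀ u → (if P u then 1 else 0) ≤ (if Q u then 1 else 0)
    indicator-mono u with P u | Q u | P⊆Q u
    ... | false | _     | _ = z≤n
    ... | true  | true  | _ = ≤-refl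
    ... | true  | false | p⇒q = ⊥-elim (p⇒q _)

  count-mono-< : ∀ {x} → ¬ T (P x) → T (Q x) → count P < count Q
  count-mono-< {x} ¬Px Qx = sum-map-mono-< indicator-mono (indicator-< (P x) (Q x) ¬Px Qx) (∈-allFin x)
    where
    indicator-< : ∀ a b → ¬ T a → T b → (if a then 1 else 0) < (if b then 1 else 0)
    indicator-< false true _ _ = s≤s z≤n
    indicator-< true _ ¬a _ = ⊥-elim (¬a _)

≤-foldr-⊔ : ∀ {x xs} → x ∈ xs → x ≤ foldr _⊔_ 0 xs
≤-foldr-⊔ {x} (here refl) = m≤m⊔n x _
≤-foldr-⊔ (there {x = y} x∈xs) = ≤-trans (≤-foldr-⊔ x∈xs) (m≤n⊔m y _)

degree≤maxDegree : ∀ {n} (G : SimpleGraph n) v → degree G v ≤ maxDegree G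
degree≤maxDegree G v = ≤-foldr-⊔ (∈-map⁺ (degree G) (∈-allFin v))

IsLeast : {A : Set} → (A → A → Set) → (A → Set) → A → Set
IsLeast _<_ P x = P x × (∀ y → y < x → ¬ P y)

least-unique : ∀ {A : Set} {_<_ : A → A → Set} → Trichotomous _≡_ _<_ →
  ∀ {P Q : A → Set} {x y} → (∀ z → P z → Q z) → (∀ z → Q z → P z) →
  IsLeast _<_ P x → IsLeast _<_ Q y → x ≡ y
least-unique compare {x = x} {y} P⇒Q Q⇒P (Px , x-least) (Qy , y-least) with compare x y
... | tri< x<y _ _ = ⊥-elim (y-least x x<y (P⇒Q x Px))
... | tri≈ _ x≡y _ = x≡y
... | tri> _ _ y<x = ⊥-elim (x-least y y<x (Q⇒P y Qy))

leastℕ : ∀ {P : ℕ → Set} → Decidable P → ∀ {m} → P m → ∃ (IsLeast _<_ P)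
leastℕ P? {zero} P0 = 0 , P0 , λ _ ()
leastℕ P? {suc m} Pm with P? 0
... | yes P0 = 0 , P0 , λ _ ()
... | no ¬P0 with leastℕ (λ k → P? (suc k)) Pm
...   | k , Pk , k-least = suc k , Pk , λ { zero _ → ¬P0 ; (suc y) (s≤s y<k) → k-least y y<k }

leastFin : ∀ {n} {P : Fin n → Set} → Decidable P → ∀ {i} → P i → ∃ (IsLeast _<ᶠ_ P)
leastFin P? {zero} P0 = zero , P0 , λ _ ()
leastFin P? {suc i} Pi with P? zero
... | yes P0 = zero , P0 , λ _ ()
... | no ¬P0 with leastFin (λ j → P? (suc j)) Pi
...   | k , Pk , k-least = suc k , Pk , λ { zero _ → ¬P0 ; (suc y) (s≤s y<k) → k-least y y<k }

AtMostTwoNeighbours : (H : Graph) → V H → Set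
AtMostTwoNeighbours H x = ∃₂ λ a b → ∀ y → E H x y → y ≡ a ⊎ y ≡ b

module _ {H : Graph} (φ : Automorphism H) where

  automorphism-injective : ∀ {x y} → fun φ x ≡ fun φ y → x ≡ y
  automorphism-injective = proj₁ (bijective φ)

  automorphism-surjective : ∀ y → ∃ λ x → fun φ x ≡ y
  automorphism-surjective y with proj₂ (bijective φ) y
  ... | x , φz≡y = x , φz≡y refl

  atMostTwoNeighbours-φ : ∀ {x} → AtMostTwoNeighbours H x → AtMostTwoNeighbours H (fun φ x)
  atMostTwoNeighbours-φ {x} (a , b , a-or-b) = fun φ a , fun φ b , φa-or-φb
    where
    φa-or-φb : ∀ y → E H (fun φ x) y → y ≡ fun φ a ⊎ y ≡ fun φ b
    φa-or-φb y φx~y with automorphism-surjective y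
    ... | z , refl = Sum.map (cong (fun φ)) (cong (fun φ)) (a-or-b z (Equivalence.from (preserves φ x z) φx~y))

  atMostTwoNeighbours-φ⁻¹ : ∀ {x} → AtMostTwoNeighbours H (fun φ x) → AtMostTwoNeighbours H x
  atMostTwoNeighbours-φ⁻¹ {x} (a , b , a-or-b) with automorphism-surjective a | automorphism-surjective b
  ... | a₀ , refl | b₀ , refl = a₀ , b₀ , λ z x~z →
    Sum.map automorphism-injective automorphism-injective (a-or-b (fun φ z) (Equivalence.to (preserves φ x z) x~z))

two-of-three : ∀ {A : Set} {a b x y z : A} → x ≡ a ⊎ x ≡ b → y ≡ a ⊎ y ≡ b → z ≡ a ⊎ z ≡ b →
               x ≡ y ⊎ x ≡ z ⊎ y ≡ z
two-of-three (inj₁ refl) (inj₁ refl) _ = inj₁ refl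
two-of-three (inj₂ refl) (inj₂ refl) _ = inj₁ refl
two-of-three (inj₁ refl) (inj₂ refl) (inj₁ refl) = inj₂ (inj₁ refl)
two-of-three (inj₁ refl) (inj₂ refl) (inj₂ refl) = inj₂ (inj₂ refl)
two-of-three (inj₂ refl) (inj₁ refl) (inj₁ refl) = inj₂ (inj₂ refl)
two-of-three (inj₂ refl) (inj₁ refl) (inj₂ refl) = inj₂ (inj₁ refl)

module _ {n} (G : SimpleGraph n) where

  _~_ : Fin n → Fin n → Set
  u ~ v = T (adj G u v)

  ~-sym : ∀ {u v} → u ~ v → v ~ u
  ~-sym {u} {v} = subst T (adj-sym G u v)

  ~-irrefl : ∀ {u v} → u ~ v → u ≢ v
  ~-irrefl {u} u~u refl = subst T (irrefl G u) u~u

  earlierNeighbour : Fin n → Fin n → Fin n → Bool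
  earlierNeighbour p v u = adj G p u ∧ ⌊ u Fin.<? v ⌋

  rank : Fin n → Fin n → ℕ
  rank p v = count (earlierNeighbour p v)

  earlierNeighbour⁺ : ∀ {p v u} → p ~ u → u <ᶠ v → T (earlierNeighbour p v u)
  earlierNeighbour⁺ {p} {v} {u} p~u u<v =
    Equivalence.from (T-∧ {adj G p u} {⌊ u Fin.<? v ⌋}) (p~u , fromWitness u<v)

  earlierNeighbour⁻ : ∀ {p v u} → T (earlierNeighbour p v u) → p ~ u × u <ᶠ v
  earlierNeighbour⁻ {p} {v} {u} h with Equivalence.to (T-∧ {adj G p u} {⌊ u Fin.<? v ⌋}) h
  ... | p~u , u<v = p~u , toWitness u<v

  rank-mono-< : ∀ {p u v} → p ~ u → u <ᶠ v → rank p u < rank p v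
  rank-mono-< {p} {u} {v} p~u u<v =
    count-mono-< {P = earlierNeighbour p u} earlier-u⊆earlier-v
      (λ h → Fin.<-irrefl refl (proj₂ (earlierNeighbour⁻ h))) (earlierNeighbour⁺ p~u u<v)
    where
    earlier-u⊆earlier-v : ∀ w → T (earlierNeighbour p u w) → T (earlierNeighbour p v w)
    earlier-u⊆earlier-v w h with earlierNeighbour⁻ h
    ... | p~w , w<u = earlierNeighbour⁺ p~w (Fin.<-trans w<u u<v)

  rank<degree : ∀ {p v} → p ~ v → rank p v < degree G p
  rank<degree {p} {v} p~v =
    count-mono-< {P = earlierNeighbour p v} {Q = adj G p} (λ w h → proj₁ (earlierNeighbour⁻ h))
      (λ h → Fin.<-irrefl refl (proj₂ (earlierNeighbour⁻ h))) p~v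

  rank-injective : ∀ {p u v} → p ~ u → p ~ v → rank p u ≡ rank p v → u ≡ v
  rank-injective {p} {u} {v} p~u p~v eq with Fin.<-cmp u v
  ... | tri< u<v _ _ = ⊥-elim (<-irrefl eq (rank-mono-< p~u u<v))
  ... | tri≈ _ u≡v _ = u≡v
  ... | tri> _ _ v<u = ⊥-elim (<-irrefl (sym eq) (rank-mono-< p~v v<u))

  2≤degree : ∀ {p u v} → u ≢ v → p ~ u → p ~ v → 2 ≤ degree G p
  2≤degree {p} {u} {v} u≢v p~u p~v with Fin.<-cmp u v
  ... | tri< u<v _ _ = ≤-<-trans (≤-trans (s≤s z≤n) (rank-mono-< p~u u<v)) (rank<degree p~v)
  ... | tri≈ _ u≡v _ = ⊥-elim (u≢v u≡v)
  ... | tri> _ _ v<u = ≤-<-trans (≤-trans (s≤s z≤n) (rank-mono-< p~v v<u)) (rank<degree p~u)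

  neighbour-on-walk : ∀ {u v} → Reachable G u v → u ≢ v → ∃ (u ~_)
  neighbour-on-walk here u≢u = ⊥-elim (u≢u refl)
  neighbour-on-walk (step u~w _) _ = _ , u~w

  asGraph : Graph
  asGraph = record { V = Fin n ; E = _~_ }

  DistinguishingTotalColouring : ∀ {d} → (Fin n → Fin d) → (Fin n → Fin n → Fin d) → Set
  DistinguishingTotalColouring col ecol =
    (σ : Automorphism asGraph) →
    (∀ v → col (fun σ v) ≡ col v) → (∀ u v → u ~ v → ecol (fun σ u) (fun σ v) ≡ ecol u v) →
    ∀ v → fun σ v ≡ v

  -- Central graphs

  _∈ₑ_ : Fin n → EdgeVertex G → Set
  x ∈ₑ (u , v , _) = x ≡ u ⊎ x ≡ v

  edgeBetween : ∀ {u v} → u ~ v → Σ (EdgeVertex G) λ e → u ∈ₑ e × v ∈ₑ e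
  edgeBetween {u} {v} u~v with Fin.<-cmp u v
  ... | tri< u<v _ _ = (u , v , u<v , u~v) , inj₁ refl , inj₂ refl
  ... | tri≈ _ u≡v _ = ⊥-elim (~-irrefl u~v u≡v)
  ... | tri> _ _ v<u = (v , u , v<u , ~-sym u~v) , inj₂ refl , inj₁ refl

  endpoints : ∀ e {x y} → x ≢ y → x ∈ₑ e → y ∈ₑ e →
              (x ≡ proj₁ e × y ≡ proj₁ (proj₂ e)) ⊎ (x ≡ proj₁ (proj₂ e) × y ≡ proj₁ e)
  endpoints _ x≢y (inj₁ refl) (inj₁ refl) = ⊥-elim (x≢y refl)
  endpoints _ x≢y (inj₁ x≡u) (inj₂ y≡v) = inj₁ (x≡u , y≡v)
  endpoints _ x≢y (inj₂ x≡v) (inj₁ y≡u) = inj₂ (x≡v , y≡u)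
  endpoints _ x≢y (inj₂ refl) (inj₂ refl) = ⊥-elim (x≢y refl)

  other-endpoint : ∀ e {u t t′} → u ∈ₑ e → t ∈ₑ e → t′ ∈ₑ e → t ≢ u → t′ ≢ u → t ≡ t′
  other-endpoint _ (inj₁ refl) (inj₁ refl) _ t≢u _ = ⊥-elim (t≢u refl)
  other-endpoint _ (inj₁ refl) (inj₂ refl) (inj₁ refl) _ t′≢u = ⊥-elim (t′≢u refl)
  other-endpoint _ (inj₁ refl) (inj₂ refl) (inj₂ refl) _ _ = refl
  other-endpoint _ (inj₂ refl) (inj₁ refl) (inj₁ refl) _ _ = refl
  other-endpoint _ (inj₂ refl) (inj₁ refl) (inj₂ refl) _ t′≢u = ⊥-elim (t′≢u refl)
  other-endpoint _ (inj₂ refl) (inj₂ refl) _ t≢u _ = ⊥-elim (t≢u refl)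

  edgeVertex-ext : ∀ e e′ → proj₁ e ∈ₑ e′ → proj₁ (proj₂ e) ∈ₑ e′ → e ≡ e′
  edgeVertex-ext (u , v , u<v , u~v) (_ , _ , u<v′ , u~v′) (inj₁ refl) (inj₂ refl) =
    cong₂ (λ lt adjacent → u , v , lt , adjacent) (Fin.<-irrelevant u<v u<v′) (T-irrelevant u~v u~v′)
  edgeVertex-ext (_ , _ , u<v , _) _ (inj₁ refl) (inj₁ refl) = ⊥-elim (Fin.<-irrefl refl u<v)
  edgeVertex-ext (_ , _ , u<v , _) _ (inj₂ refl) (inj₂ refl) = ⊥-elim (Fin.<-irrefl refl u<v)
  edgeVertex-ext (_ , _ , u<v , _) (_ , _ , v<u , _) (inj₂ refl) (inj₁ refl) = ⊥-elim (Fin.<-asym u<v v<u)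

  edgeVertex-atMostTwoNeighbours : ∀ e → AtMostTwoNeighbours (central G) (inj₂ e)
  edgeVertex-atMostTwoNeighbours (u , v , _) = inj₁ u , inj₁ v , λ where
    (inj₁ x) x∈e → Sum.map (cong inj₁) (cong inj₁) x∈e

  centralNeighbour : Fin n → Fin n → CV G
  centralNeighbour u t with T? (adj G u t)
  ... | yes u~t = inj₂ (proj₁ (edgeBetween u~t))
  ... | no _ = inj₁ t

  centralNeighbour-adjacent : ∀ {u t} → t ≢ u → CE G (inj₁ u) (centralNeighbour u t)
  centralNeighbour-adjacent {u} {t} t≢u with T? (adj G u t)
  ... | yes u~t = proj₁ (proj₂ (edgeBetween u~t))
  ... | no ¬u~t = (λ u≡t → t≢u (sym u≡t)) , dec-false (T? (adj G u t)) ¬u~t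

  centralNeighbour-injective : ∀ {u t t′} → t ≢ u → t′ ≢ u → centralNeighbour u t ≡ centralNeighbour u t′ → t ≡ t′
  centralNeighbour-injective {u} {t} {t′} t≢u t′≢u eq with T? (adj G u t) | T? (adj G u t′)
  ... | yes u~t | yes u~t′ with edgeBetween u~t | edgeBetween u~t′ | inj₂-injective eq
  ...   | e , u∈e , t∈e | _ , u∈e′ , t′∈e′ | refl = other-endpoint e u∈e t∈e t′∈e′ t≢u t′≢u
  centralNeighbour-injective _ _ () | yes _ | no _
  centralNeighbour-injective _ _ () | no _ | yes _
  centralNeighbour-injective _ _ eq | no _ | no _ = inj₁-injective eq

  centralColouring : ∀ {d} → (Fin n → Fin d) → (Fin n → Fin n → Fin d) → CV G → Fin d
  centralColouring col ecol (inj₁ v) = col v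
  centralColouring col ecol (inj₂ (u , v , _)) = ecol u v

  centralColouring-edge : ∀ {d} (col : Fin n → Fin d) {ecol} → (∀ u v → ecol u v ≡ ecol v u) →
                          ∀ e {x y} → x ≢ y → x ∈ₑ e → y ∈ₑ e → centralColouring col ecol (inj₂ e) ≡ ecol x y
  centralColouring-edge col ecol-sym e x≢y x∈e y∈e with endpoints e x≢y x∈e y∈e
  ... | inj₁ (refl , refl) = refl
  ... | inj₂ (refl , refl) = ecol-sym _ _

  module Restriction (vertices-¬atMostTwo : ∀ u → ¬ AtMostTwoNeighbours (central G) (inj₁ u))
                     (φ : Automorphism (central G)) where

    vertex-image : ∀ u → ∃ λ v → fun φ (inj₁ u) ≡ inj₁ v
    vertex-image u with fun φ (inj₁ u) in φu≡
    ... | inj₁ v = v , refl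
    ... | inj₂ e = ⊥-elim (vertices-¬atMostTwo u (atMostTwoNeighbours-φ⁻¹ φ
                     (subst (AtMostTwoNeighbours (central G)) (sym φu≡) (edgeVertex-atMostTwoNeighbours e))))

    edge-image : ∀ e → ∃ λ e′ → fun φ (inj₂ e) ≡ inj₂ e′
    edge-image e with fun φ (inj₂ e) in φe≡
    ... | inj₂ e′ = e′ , refl
    ... | inj₁ v = ⊥-elim (vertices-¬atMostTwo v
                     (subst (AtMostTwoNeighbours (central G)) φe≡ (atMostTwoNeighbours-φ φ (edgeVertex-atMostTwoNeighbours e))))

    σ : Fin n → Fin n
    σ u = proj₁ (vertex-image u)

    σ-spec : ∀ u → fun φ (inj₁ u) ≡ inj₁ (σ u)
    σ-spec u = proj₂ (vertex-image u)

    σ-injective : ∀ {u v} → σ u ≡ σ v → u ≡ v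
    σ-injective {u} {v} σu≡σv =
      inj₁-injective (automorphism-injective φ (trans (σ-spec u) (trans (cong inj₁ σu≡σv) (sym (σ-spec v)))))

    σ-surjective : ∀ v → ∃ λ u → σ u ≡ v
    σ-surjective v with automorphism-surjective φ (inj₁ v)
    ... | inj₁ u , φu≡v = u , inj₁-injective (trans (sym (σ-spec u)) φu≡v)
    ... | inj₂ e , φe≡v with trans (sym (proj₂ (edge-image e))) φe≡v
    ...   | ()

    adj-σ : ∀ u v → adj G (σ u) (σ v) ≡ adj G u v
    adj-σ u v with u Fin.≟ v
    ... | yes refl = trans (irrefl G (σ u)) (sym (irrefl G u))
    ... | no u≢v = ⇔→≡ {z = false} (mk⇔
          (λ σ-nonadjacent → proj₂ (Equivalence.from non-adjacency (σ-≢ , σ-nonadjacent)))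
          (λ nonadjacent → proj₂ (Equivalence.to non-adjacency (u≢v , nonadjacent))))
      where
      σ-≢ : σ u ≢ σ v
      σ-≢ σu≡σv = u≢v (σ-injective σu≡σv)
      non-adjacency : CE G (inj₁ u) (inj₁ v) ⇔ CE G (inj₁ (σ u)) (inj₁ (σ v))
      non-adjacency = subst₂ (λ x y → CE G (inj₁ u) (inj₁ v) ⇔ CE G x y) (σ-spec u) (σ-spec v) (preserves φ (inj₁ u) (inj₁ v))

    σ-automorphism : Automorphism asGraph
    σ-automorphism = record
      { fun = σ
      ; bijective = σ-injective , λ v → proj₁ (σ-surjective v) , λ { refl → proj₂ (σ-surjective v) }
      ; preserves = λ u v → mk⇔ (subst T (sym (adj-σ u v))) (subst T (adj-σ u v))
      }

    edge-image-∋ : ∀ e {x} → x ∈ₑ e → σ x ∈ₑ proj₁ (edge-image e)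
    edge-image-∋ e {x} x∈e = subst₂ (CE G) (proj₂ (edge-image e)) (σ-spec x) (Equivalence.to (preserves φ (inj₂ e) (inj₁ x)) x∈e)

  central-distinguishing : ∀ {d} {col : Fin n → Fin d} {ecol} →
    (∀ u → ¬ AtMostTwoNeighbours (central G) (inj₁ u)) → (∀ u v → ecol u v ≡ ecol v u) →
    DistinguishingTotalColouring col ecol → Distinguishing (central G) d (centralColouring col ecol)
  central-distinguishing {d} {col} {ecol} vertices-¬atMostTwo ecol-sym distinguishingTotalColouring φ φ-preserves = φ-fixes
    where
    open Restriction vertices-¬atMostTwo φ
    f : CV G → Fin d
    f = centralColouring col ecol

    col-σ : ∀ v → col (σ v) ≡ col v
    col-σ v = trans (cong f (sym (σ-spec v))) (φ-preserves (inj₁ v))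

    ecol-σ : ∀ u v → u ~ v → ecol (σ u) (σ v) ≡ ecol u v
    ecol-σ u v u~v with edgeBetween u~v
    ... | e , u∈e , v∈e = begin
      ecol (σ u) (σ v)                ≡⟨ centralColouring-edge col ecol-sym (proj₁ (edge-image e)) σu≢σv (edge-image-∋ e u∈e) (edge-image-∋ e v∈e) ⟨
      f (inj₂ (proj₁ (edge-image e))) ≡⟨ cong f (proj₂ (edge-image e)) ⟨
      f (fun φ (inj₂ e))              ≡⟨ φ-preserves (inj₂ e) ⟩
      f (inj₂ e)                      ≡⟨ centralColouring-edge col ecol-sym e u≢v u∈e v∈e ⟩
      ecol u v                        ∎
      where
      open ≡-Reasoning
      u≢v : u ≢ v
      u≢v = ~-irrefl u~v
      σu≢σv : σ u ≢ σ v
      σu≢σv σu≡σv = u≢v (σ-injective σu≡σv)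

    σ-identity : ∀ v → σ v ≡ v
    σ-identity = distinguishingTotalColouring σ-automorphism col-σ ecol-σ

    φ-fixes : ∀ x → fun φ x ≡ x
    φ-fixes (inj₁ v) = trans (σ-spec v) (cong inj₁ (σ-identity v))
    φ-fixes (inj₂ e) = trans (proj₂ (edge-image e)) (cong inj₂ (sym (edgeVertex-ext e (proj₁ (edge-image e))
      (subst (_∈ₑ proj₁ (edge-image e)) (σ-identity _) (edge-image-∋ e (inj₁ refl)))
      (subst (_∈ₑ proj₁ (edge-image e)) (σ-identity _) (edge-image-∋ e (inj₂ refl))))))

  -- Breadth-first spanning trees

  module BreadthFirstTree (connected : Connected G) (r : Fin n) {s₀ : Fin n} (r~s₀ : r ~ s₀) where

    Within : ℕ → Fin n → Set
    Within zero v = v ≡ r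
    Within (suc k) v = Within k v ⊎ ∃ λ u → Within k u × u ~ v

    within? : ∀ k → Decidable (Within k)
    within? zero v = v Fin.≟ r
    within? (suc k) v = within? k v ⊎-dec Fin.any? (λ u → within? k u ×-dec T? (adj G u v))

    within-walk : ∀ {k u v} → Within k u → Reachable G u v → ∃ λ m → Within m v
    within-walk {k} w here = k , w
    within-walk {k} w (step u~x x⇝v) = within-walk {suc k} (inj₂ (_ , w , u~x)) x⇝v

    leastLevel : ∀ v → ∃ (IsLeast _<_ (λ k → Within k v))
    leastLevel v = leastℕ (λ k → within? k v) (proj₂ (within-walk {0} refl (connected r v)))

    level : Fin n → ℕ
    level v = proj₁ (leastLevel v)

    within-level : ∀ v → Within (level v) v
    within-level v = proj₁ (proj₂ (leastLevel v))

    level-minimal : ∀ {k v} → Within k v → level v ≤ k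
    level-minimal {k} {v} w = ≮⇒≥ (λ k<level → proj₂ (proj₂ (leastLevel v)) k k<level w)

    level-root : level r ≡ 0
    level-root = n≤0⇒n≡0 (level-minimal {0} refl)

    level≡0⇒root : ∀ {v} → level v ≡ 0 → v ≡ r
    level≡0⇒root {v} eq = subst (λ k → Within k v) eq (within-level v)

    level-~ : ∀ {u v} → u ~ v → level v ≤ suc (level u)
    level-~ {u} u~v = level-minimal {suc (level u)} (inj₂ (u , within-level u , u~v))

    ParentCandidate : Fin n → Fin n → Set
    ParentCandidate v u = u ~ v × suc (level u) ≡ level v

    parentParentCandidate? : ∀ v → Decidable (ParentCandidate v)
    parentParentCandidate? v u = T? (adj G u v) ×-dec (suc (level u) ℕ.≟ level v)

    parentParentCandidate-exists : ∀ {v} → v ≢ r → ∃ (ParentCandidate v)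
    parentParentCandidate-exists {v} v≢r = from-within (level v) refl (within-level v)
      where
      from-within : ∀ ℓ → level v ≡ ℓ → Within ℓ v → ∃ (ParentCandidate v)
      from-within zero level≡0 _ = ⊥-elim (v≢r (level≡0⇒root level≡0))
      from-within (suc m) level≡1+m (inj₁ w) = ⊥-elim (1+n≰n (subst (_≤ m) level≡1+m (level-minimal w)))
      from-within (suc m) level≡1+m (inj₂ (u , w , u~v)) =
        u , u~v , ≤-antisym (subst (suc (level u) ≤_) (sym level≡1+m) (s≤s (level-minimal w))) (level-~ u~v)

    -- The root has no candidate; sending it to s₀ makes the slot of s₀ the one that the root
    -- exchanges for the reserved code in childCode.
    parent : Fin n → Fin n
    parent v with Fin.any? (parentParentCandidate? v)
    ... | yes (_ , c) = proj₁ (leastFin (parentParentCandidate? v) c)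
    ... | no _ = s₀

    parent-candidate : ∀ {v} → v ≢ r → ParentCandidate v (parent v)
    parent-candidate {v} v≢r with Fin.any? (parentParentCandidate? v)
    ... | yes (_ , c) = proj₁ (proj₂ (leastFin (parentParentCandidate? v) c))
    ... | no none = ⊥-elim (none (parentParentCandidate-exists v≢r))

    parent-root : parent r ≡ s₀
    parent-root with Fin.any? (parentParentCandidate? r)
    ... | yes (u , _ , 1+level≡0) = ⊥-elim (1+n≢0 (trans 1+level≡0 level-root))
    ... | no _ = refl

    parent-cong : ∀ {v w} → (∀ u → ParentCandidate v u → ParentCandidate w u) → (∀ u → ParentCandidate w u → ParentCandidate v u) →
                  parent v ≡ parent w
    parent-cong {v} {w} v⇒w w⇒v with Fin.any? (parentParentCandidate? v) | Fin.any? (parentParentCandidate? w)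
    ... | yes (_ , c) | yes (_ , c′) =
      least-unique Fin.<-cmp v⇒w w⇒v (proj₂ (leastFin (parentParentCandidate? v) c)) (proj₂ (leastFin (parentParentCandidate? w) c′))
    ... | yes (u , c) | no none = ⊥-elim (none (u , v⇒w u c))
    ... | no none | yes (u , c) = ⊥-elim (none (u , w⇒v u c))
    ... | no _ | no _ = refl

    parent~ : ∀ v → parent v ~ v
    parent~ v with v Fin.≟ r
    ... | yes refl = subst (_~ r) (sym parent-root) (~-sym r~s₀)
    ... | no v≢r = proj₁ (parent-candidate v≢r)

    Child : Fin n → Fin n → Set
    Child v p = v ≢ r × parent v ≡ p

    child? : ∀ v p → Dec (Child v p)
    child? v p = ¬? (v Fin.≟ r) ×-dec (parent v Fin.≟ p)

    child-level : ∀ {v p} → Child v p → suc (level p) ≡ level v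
    child-level (v≢r , refl) = proj₂ (parent-candidate v≢r)

    child~ : ∀ {v p} → Child v p → p ~ v
    child~ {v} (_ , refl) = parent~ v

    child-asym : ∀ {u v} → Child u v → ¬ Child v u
    child-asym u→v v→u = <-asym (≤-reflexive (child-level u→v)) (≤-reflexive (child-level v→u))

    s₀-child : Child s₀ r
    s₀-child = s₀≢r , level≡0⇒root (n≤0⇒n≡0 (≤-pred 1+level-parent≤1))
      where
      s₀≢r : s₀ ≢ r
      s₀≢r s₀≡r = ~-irrefl r~s₀ (sym s₀≡r)
      1+level-parent≤1 : suc (level (parent s₀)) ≤ 1
      1+level-parent≤1 = begin
        suc (level (parent s₀)) ≡⟨ proj₂ (parent-candidate s₀≢r) ⟩
        level s₀                ≤⟨ level-~ r~s₀ ⟩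
        suc (level r)           ≡⟨ cong suc level-root ⟩
        1                       ∎
        where open ≤-Reasoning

    module _ (σ : Automorphism asGraph) (σ-root : fun σ r ≡ r) where

      private
        σ~ : ∀ {u v} → u ~ v → fun σ u ~ fun σ v
        σ~ {u} {v} = Equivalence.to (preserves σ u v)

        σ~⁻¹ : ∀ {u v} → fun σ u ~ fun σ v → u ~ v
        σ~⁻¹ {u} {v} = Equivalence.from (preserves σ u v)

      within-σ : ∀ k v → Within k v → Within k (fun σ v)
      within-σ zero v refl = σ-root
      within-σ (suc k) v (inj₁ w) = inj₁ (within-σ k v w)
      within-σ (suc k) v (inj₂ (u , w , u~v)) = inj₂ (fun σ u , within-σ k u w , σ~ u~v)

      within-σ⁻¹ : ∀ k v → Within k (fun σ v) → Within k v
      within-σ⁻¹ zero v σv≡r = automorphism-injective σ (trans σv≡r (sym σ-root))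
      within-σ⁻¹ (suc k) v (inj₁ w) = inj₁ (within-σ⁻¹ k v w)
      within-σ⁻¹ (suc k) v (inj₂ (u , w , u~σv)) with automorphism-surjective σ u
      ... | x , refl = inj₂ (x , within-σ⁻¹ k x w , σ~⁻¹ u~σv)

      level-σ : ∀ v → level (fun σ v) ≡ level v
      level-σ v = least-unique ℕ.<-cmp (λ k → within-σ⁻¹ k v) (λ k → within-σ k v)
                    (proj₂ (leastLevel (fun σ v))) (proj₂ (leastLevel v))

      parent-σ : ∀ {v} → (∀ u → suc (level u) ≡ level v → fun σ u ≡ u) → parent (fun σ v) ≡ parent v
      parent-σ {v} fixed = parent-cong σv⇒v v⇒σv
        where
        σv⇒v : ∀ u → ParentCandidate (fun σ v) u → ParentCandidate v u
        σv⇒v u (u~σv , level-u) = σ~⁻¹ (subst (_~ fun σ v) (sym (fixed u lu≡lv)) u~σv) , lu≡lv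
          where
          lu≡lv : suc (level u) ≡ level v
          lu≡lv = trans level-u (level-σ v)
        v⇒σv : ∀ u → ParentCandidate v u → ParentCandidate (fun σ v) u
        v⇒σv u (u~v , level-u) = subst (_~ fun σ v) (fixed u level-u) (σ~ u~v) , trans level-u (sym (level-σ v))

    -- The colouring

    module Colouring (k : ℕ) (Δ≤d² : maxDegree G ≤ (2 + k) * (2 + k)) where

      d : ℕ
      d = 2 + k

      0̂ 1̂ : Fin d
      0̂ = zero
      1̂ = suc zero

      1̂≢0̂ : 1̂ ≢ 0̂
      1̂≢0̂ ()

      slot : ℕ → Fin (d * d)
      slot j = j mod (d * d)

      slot-injective : ∀ {i j} → i < d * d → j < d * d → slot i ≡ slot j → i ≡ j
      slot-injective {i} {j} i<d² j<d² eq = begin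
        i                     ≡⟨ m<n⇒m%n≡m i<d² ⟨
        i % (d * d)           ≡⟨ toℕ-fromℕ< (m%n<n i (d * d)) ⟨
        toℕ (slot i)      ≡⟨ cong toℕ eq ⟩
        toℕ (slot j)      ≡⟨ toℕ-fromℕ< (m%n<n j (d * d)) ⟩
        j % (d * d)           ≡⟨ m<n⇒m%n≡m j<d² ⟩
        j                     ∎
        where open ≡-Reasoning

      rank<d² : ∀ {p v} → p ~ v → rank p v < d * d
      rank<d² {p} p~v = <-≤-trans (rank<degree p~v) (≤-trans (degree≤maxDegree G p) Δ≤d²)

      -- The codes a child must carry for the edge to its parent to match RootSignature, in either
      -- orientation, given the colour of the parent.
      reserved : Fin d → Fin (d * d)
      reserved zero = combine 1̂ 1̂
      reserved (suc _) = combine 0̂ 1̂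

      -- A code packs the colour of a vertex and the colour of the edge to its parent. The children of
      -- p are numbered by their rank among the neighbours of p, and the slot of p's own parent,
      -- which no child of p ≠ r occupies, is exchanged for the reserved code.
      childCode : Fin (d * d) → Fin n → Fin n → Fin (d * d)
      childCode c p v = transpose (slot (rank p (parent p))) (reserved (quotient {d} d c)) ⟨$⟩ʳ slot (rank p v)

      codeAt : ℕ → Fin n → Fin (d * d)
      codeAt zero v = combine 0̂ 0̂
      codeAt (suc ℓ) v = childCode (codeAt ℓ (parent v)) (parent v) v

      code : Fin n → Fin (d * d)
      code v = codeAt (level v) v

      col tag : Fin n → Fin d
      col v = quotient {d} d (code v)
      tag v = remainder {d} d (code v)

      ecol : Fin n → Fin n → Fin d
      ecol u v with child? v u | child? u v
      ... | yes _ | _ = tag v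
      ... | no _ | yes _ = tag u
      ... | no _ | no _ = 0̂

      code-root : code r ≡ combine 0̂ 0̂
      code-root = cong (λ ℓ → codeAt ℓ r) level-root

      col-root : col r ≡ 0̂
      col-root = trans (cong (quotient {d} d) code-root) (cong proj₁ (remQuot-combine 0̂ 0̂))

      code-child : ∀ {v p} → Child v p → code v ≡ childCode (code p) p v
      code-child {v} (v≢r , refl) = cong (λ ℓ → codeAt ℓ v) (sym (child-level (v≢r , refl)))

      code≡combine : ∀ v → code v ≡ combine (col v) (tag v)
      code≡combine v = sym (combine-remQuot {d} d (code v))

      childCode-injective : ∀ {c p u v} → p ~ u → p ~ v → childCode c p u ≡ childCode c p v → u ≡ v
      childCode-injective p~u p~v eq =
        rank-injective p~u p~v (slot-injective (rank<d² p~u) (rank<d² p~v) (Injection.injective (↔⇒↣ (transpose _ _)) eq))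

      reserved≡childCode-parent : ∀ c p → reserved (quotient {d} d c) ≡ childCode c p (parent p)
      reserved≡childCode-parent c p = sym (transpose-here (slot (rank p (parent p))) (reserved (quotient {d} d c)))
        where
        transpose-here : ∀ {m} (i j : Fin m) → transpose i j ⟨$⟩ʳ i ≡ j
        transpose-here i j rewrite dec-true (i Fin.≟ i) refl = refl

      code≡reserved⇒parent : ∀ {v p} → Child v p → code v ≡ reserved (col p) → v ≡ parent p
      code≡reserved⇒parent {v} {p} v→p eq =
        childCode-injective {code p} (child~ v→p) (~-sym (parent~ p))
          (trans (sym (code-child v→p)) (trans eq (reserved≡childCode-parent (code p) p)))

      code≡reserved⇒root : ∀ {v p} → Child v p → code v ≡ reserved (col p) → p ≡ r
      code≡reserved⇒root {v} {p} v→p eq with p Fin.≟ r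
      ... | yes p≡r = p≡r
      ... | no p≢r = ⊥-elim (child-asym v→p (p≢r , sym (code≡reserved⇒parent v→p eq)))

      ecol-child : ∀ {u v} → Child v u → ecol u v ≡ tag v
      ecol-child {u} {v} v→u with child? v u
      ... | yes _ = refl
      ... | no ¬v→u = ⊥-elim (¬v→u v→u)

      ecol-sym : ∀ u v → ecol u v ≡ ecol v u
      ecol-sym u v with child? v u | child? u v
      ... | yes v→u | yes u→v = ⊥-elim (child-asym v→u u→v)
      ... | yes _ | no _ = refl
      ... | no _ | yes _ = refl
      ... | no _ | no _ = refl

      ecol-parent : ∀ {u v} → Child u v → ecol u v ≡ tag u
      ecol-parent {u} {v} u→v = trans (ecol-sym u v) (ecol-child u→v)

      ecol≢0̂⇒tree-edge : ∀ {u v} → ecol u v ≢ 0̂ → Child v u ⊎ Child u v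
      ecol≢0̂⇒tree-edge {u} {v} ecol≢0̂ with child? v u | child? u v
      ... | yes v→u | _ = inj₁ v→u
      ... | no _ | yes u→v = inj₂ u→v
      ... | no _ | no _ = ⊥-elim (ecol≢0̂ refl)

      code≡combine-colours : ∀ {v a b} → col v ≡ a → tag v ≡ b → code v ≡ combine a b
      code≡combine-colours {v} refl refl = code≡combine v

      RootSignature : Fin n → Fin n → Set
      RootSignature u v = u ~ v × col u ≡ 0̂ × col v ≡ 1̂ × ecol u v ≡ 1̂

      root-signature : RootSignature r s₀
      root-signature =
        r~s₀ , col-root , cong proj₁ colours-s₀ , trans (ecol-child s₀-child) (cong proj₂ colours-s₀)
        where
        code-s₀ : code s₀ ≡ combine 1̂ 1̂
        code-s₀ = begin
          code s₀                          ≡⟨ code-child s₀-child ⟩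
          childCode (code r) r s₀          ≡⟨ cong (childCode (code r) r) parent-root ⟨
          childCode (code r) r (parent r)  ≡⟨ reserved≡childCode-parent (code r) r ⟨
          reserved (col r)                 ≡⟨ cong reserved col-root ⟩
          combine 1̂ 1̂                      ∎
          where open ≡-Reasoning
        colours-s₀ : (col s₀ , tag s₀) ≡ (1̂ , 1̂)
        colours-s₀ = trans (cong (remQuot {d} d) code-s₀) (remQuot-combine 1̂ 1̂)

      root-signature-unique : ∀ {u v} → RootSignature u v → u ≡ r
      root-signature-unique {u} {v} (_ , col-u , col-v , ecol-uv) with ecol≢0̂⇒tree-edge {u} {v} (1̂≢0̂ ∘ trans (sym ecol-uv))
      ... | inj₁ v→u = code≡reserved⇒root v→u
        (trans (code≡combine-colours col-v (trans (sym (ecol-child v→u)) ecol-uv)) (cong reserved (sym col-u)))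
      ... | inj₂ u→v = ⊥-elim (1̂≢0̂ (trans (sym col-v) (trans (cong col v≡r) col-root)))
        where
        v≡r : v ≡ r
        v≡r = code≡reserved⇒root u→v
          (trans (code≡combine-colours col-u (trans (sym (ecol-parent u→v)) ecol-uv)) (cong reserved (sym col-v)))

      module Rigidity (σ : Automorphism asGraph)
                      (col-σ : ∀ v → col (fun σ v) ≡ col v)
                      (ecol-σ : ∀ u v → u ~ v → ecol (fun σ u) (fun σ v) ≡ ecol u v) where

        σ-root : fun σ r ≡ r
        σ-root = root-signature-unique signature-σ
          where
          signature-σ : RootSignature (fun σ r) (fun σ s₀)
          signature-σ with root-signature
          ... | r~s₀ , col-r , col-s₀ , ecol-rs₀ =
            Equivalence.to (preserves σ r s₀) r~s₀ , trans (col-σ r) col-r , trans (col-σ s₀) col-s₀ ,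
            trans (ecol-σ r s₀ r~s₀) ecol-rs₀

        fixed-at-next-level : ∀ {m v} → (∀ u → level u ≤ m → fun σ u ≡ u) → level v ≡ suc m → fun σ v ≡ v
        fixed-at-next-level {m} {v} fixed level-v =
          childCode-injective {code p} (child~ σv→p) (child~ v→p) (begin
            childCode (code p) p (fun σ v)             ≡⟨ code-child σv→p ⟨
            code (fun σ v)                             ≡⟨ code≡combine (fun σ v) ⟩
            combine (col (fun σ v)) (tag (fun σ v))    ≡⟨ cong₂ combine (col-σ v) tag-σ ⟩
            combine (col v) (tag v)                    ≡⟨ code≡combine v ⟨
            code v                                     ≡⟨ code-child v→p ⟩
            childCode (code p) p v                     ∎)
          where
          open ≡-Reasoning
          p : Fin n
          p = parent v
          v≢r : v ≢ r
          v≢r refl = 1+n≢0 (trans (sym level-v) level-root)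
          v→p : Child v p
          v→p = v≢r , refl
          fixed-above : ∀ u → suc (level u) ≡ level v → fun σ u ≡ u
          fixed-above u 1+level-u≡level-v = fixed u (≤-reflexive (suc-injective (trans 1+level-u≡level-v level-v)))
          σv→p : Child (fun σ v) p
          σv→p = (λ σv≡r → v≢r (automorphism-injective σ (trans σv≡r (sym σ-root)))) , parent-σ σ σ-root fixed-above
          tag-σ : tag (fun σ v) ≡ tag v
          tag-σ = begin
            tag (fun σ v)            ≡⟨ ecol-child σv→p ⟨
            ecol p (fun σ v)         ≡⟨ cong (λ x → ecol x (fun σ v)) (fixed-above p (child-level v→p)) ⟨
            ecol (fun σ p) (fun σ v) ≡⟨ ecol-σ p v (child~ v→p) ⟩
            ecol p v                 ≡⟨ ecol-child v→p ⟩
            tag v                    ∎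

        fixed-up-to : ∀ m v → level v ≤ m → fun σ v ≡ v
        fixed-up-to zero v level≤0 = subst (λ x → fun σ x ≡ x) (sym (level≡0⇒root (n≤0⇒n≡0 level≤0))) σ-root
        fixed-up-to (suc m) v level≤1+m with m≤n⇒m<n∨m≡n level≤1+m
        ... | inj₁ level<1+m = fixed-up-to m v (≤-pred level<1+m)
        ... | inj₂ level≡1+m = fixed-at-next-level (fixed-up-to m) level≡1+m

      distinguishing : DistinguishingTotalColouring col ecol
      distinguishing σ col-σ ecol-σ v = Rigidity.fixed-up-to σ col-σ ecol-σ (level v) v ≤-refl

ceilSqrt-go-sound : ∀ m k fuel → m ≤ k + fuel → m ≤ ceilSqrt-go m k fuel * ceilSqrt-go m k fuel
ceilSqrt-go-sound m zero zero m≤0 = m≤0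
ceilSqrt-go-sound m (suc k) zero m≤k = ≤-trans m≤k (≤-trans (≤-reflexive (+-identityʳ (suc k))) (m≤m*n (suc k) (suc k)))
ceilSqrt-go-sound m k (suc fuel) m≤k+fuel with m ≤ᵇ k * k in found
... | true = ≤ᵇ⇒≤ m (k * k) (subst T (sym found) _)
... | false = ceilSqrt-go-sound m (suc k) fuel (≤-trans m≤k+fuel (≤-reflexive (+-suc k fuel)))

≤ceilSqrt² : ∀ m → m ≤ ceilSqrt m * ceilSqrt m
≤ceilSqrt² m = ceilSqrt-go-sound m 0 m ≤-refl

2≤ceilSqrt : ∀ {m} → 2 ≤ m → 2 ≤ ceilSqrt m
2≤ceilSqrt {m} 2≤m = 2≤root (ceilSqrt m) (≤-trans 2≤m (≤ceilSqrt² m))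
  where
  2≤root : ∀ c → 2 ≤ c * c → 2 ≤ c
  2≤root (suc (suc c)) _ = s≤s (s≤s z≤n)
  2≤root (suc zero) (s≤s ())

2≤maxDegree-leaving-edge : ∀ {n} (G : SimpleGraph n) {p u w} →
  _~_ G p u → Reachable G u w → w ≢ p → w ≢ u → 2 ≤ maxDegree G
2≤maxDegree-leaving-edge G p~u here w≢p w≢u = ⊥-elim (w≢u refl)
2≤maxDegree-leaving-edge G {p} {u} p~u (step {v = v} u~v v⇝w) w≢p w≢u with v Fin.≟ p
... | yes refl = 2≤maxDegree-leaving-edge G u~v v⇝w w≢u w≢p
... | no v≢p = ≤-trans (2≤degree G (λ p≡v → v≢p (sym p≡v)) (~-sym G p~u) u~v) (degree≤maxDegree G u)

2≤maxDegree : ∀ {m} (G : SimpleGraph (suc m)) → 2 ≤ m → Connected G → 2 ≤ maxDegree G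
2≤maxDegree G (s≤s (s≤s _)) connected with connected zero (suc zero)
... | step {v = v} 0~v _ with v Fin.≟ suc zero
...   | yes refl = 2≤maxDegree-leaving-edge G 0~v (connected v (suc (suc zero))) (λ ()) (λ ())
...   | no v≢1 = 2≤maxDegree-leaving-edge G 0~v (connected v (suc zero)) (λ ()) (λ 1≡v → v≢1 (sym 1≡v))

vertex-¬atMostTwoNeighbours : ∀ {m} (G : SimpleGraph (suc m)) → 3 ≤ m → ∀ u → ¬ AtMostTwoNeighbours (central G) (inj₁ u)
vertex-¬atMostTwoNeighbours G (s≤s (s≤s (s≤s _))) u (a , b , a-or-b) =
  no-two-equal (two-of-three (near zero) (near (suc zero)) (near (suc (suc zero))))
  where
  y : Fin _ → CV G
  y i = centralNeighbour G u (punchIn u i)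
  near : ∀ i → y i ≡ a ⊎ y i ≡ b
  near i = a-or-b (y i) (centralNeighbour-adjacent G (Fin.punchInᵢ≢i u i))
  y-injective : ∀ {i j} → y i ≡ y j → i ≡ j
  y-injective {i} {j} yi≡yj =
    Fin.punchIn-injective u i j (centralNeighbour-injective G (Fin.punchInᵢ≢i u i) (Fin.punchInᵢ≢i u j) yi≡yj)
  no-two-equal : y zero ≡ y (suc zero) ⊎ y zero ≡ y (suc (suc zero)) ⊎ y (suc zero) ≡ y (suc (suc zero)) → ⊥
  no-two-equal (inj₁ y0≡y1) with y-injective y0≡y1
  ... | ()
  no-two-equal (inj₂ (inj₁ y0≡y2)) with y-injective y0≡y2
  ... | ()
  no-two-equal (inj₂ (inj₂ y1≡y2)) with y-injective y1≡y2
  ... | ()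

central-hasDistinguishingColouring : ∀ {m} (G : SimpleGraph (suc m)) → 3 ≤ m → Connected G →
  ∀ {d} → 2 ≤ d → maxDegree G ≤ d * d → HasDistinguishingColouring (central G) d
central-hasDistinguishingColouring G 3≤m@(s≤s _) connected {suc (suc k)} (s≤s (s≤s z≤n)) Δ≤d² =
  centralColouring G col ecol , central-distinguishing G (vertex-¬atMostTwoNeighbours G 3≤m) ecol-sym distinguishing
  where
  root-neighbour : ∃ (_~_ G zero)
  root-neighbour = neighbour-on-walk G (connected zero (suc zero)) (λ ())
  open BreadthFirstTree G connected zero (proj₂ root-neighbour)
  open Colouring k Δ≤d²

theorem3p4 : (n : ℕ) (G : SimpleGraph n) → 4 ≤ n → Connected G →
             DistNumberAtMost (central G) (ceilSqrt (maxDegree G))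
theorem3p4 (suc m) G (s≤s 3≤m) connected =
  ceilSqrt (maxDegree G) , ≤-refl ,
  central-hasDistinguishingColouring G 3≤m connected
    (2≤ceilSqrt (2≤maxDegree G (<⇒≤ 3≤m) connected)) (≤ceilSqrt² (maxDegree G))
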